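{- Let $G$ be a matching covered graph and let $\{u,v\}$ be a $2$-separation of $G$ giving rise to a $2$-separation cut $D=\partial(Y)$, with notation chosen so that $u\in Y$ and $v\in\overline{Y}$. Let $G'=G/(\overline{Y}\rightarrow\overline{y})$ and let $B$ be a barrier of $G'$. If $\overline{y}\in B$, then $(B-\overline{y})\cup\{v\}$ is a barrier of $G$. If $\overline{y}\notin B$, then $B$ is a barrier of $G$.
   Context: All graphs are finite, undirected and loopless. A graph is matchable if it has a perfect matching; it is matching covered if it is connected, has at least two vertices, and every edge lies in some perfect matching. For $X\subseteq V(G)$, $\overline{X}=V(G)\setminus X$, $\partial(X)$ is the set of edges with exactly one end in $X$, and $G/(X\rightarrow x)$ denotes the graph obtained by shrinking $X$ to a single new vertex $x$ (edges inside $X$ deleted, edges of $\partial(X)$ become incident with $x$). A barrier of a matchable graph $G$ is a set $B\subseteq V(G)$ with $o(G-B)=|B|$, where $o(\cdot)$ is the number of odd components. A pair of distinct vertices $\{u,v\}$ of a matching covered graph $G$ is a $2$-separation if $G=G_1\cup G_2$ with $V(G_1)\cap V(G_2)=\{u,v\}$ and $|V(G_1)|,|V(G_2)|$ both even; the cuts $\partial(V(G_1)-u)$ and $\partial(V(G_2)-v)$ are the $2$-separation cuts arising from $\{u,v\}$. -}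

module Defs where

open import Data.Nat using (ℕ; zero; suc; _+_; _%_; _≡ᵇ_; _≤_)
open import Data.Fin using (Fin; zero; suc; _≟_)
open import Data.Bool using (Bool; true; false; _∧_; _∨_; not; if_then_else_)
open import Data.Product using (Σ; ∃; _×_; _,_)
open import Data.Sum using (_⊎_)
open import Relation.Binary.PropositionalEquality using (_≡_; refl)
open import Relation.Nullary.Decidable using (⌊_⌋)

VSet : ℕ → Set
VSet n = Fin n → Bool

count : ∀ {n} → VSet n → ℕ
count {zero}  S = 0
count {suc n} S = (if S zero then 1 else 0) + count (λ x → S (suc x))

anyF : ∀ {n} → VSet n → Bool
anyF {zero}  S = false
anyF {suc n} S = S zero ∨ anyF (λ x → S (suc x))

-- A finite loopless graph whose vertex set is the subset 'vert' of Fin n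
-- (adjacency between non-vertices is irrelevant).  Parallel edges are
-- collapsed: only the adjacency relation is recorded.
record Graph (n : ℕ) : Set where
  field
    vert       : VSet n
    adj        : Fin n → Fin n → Bool
    adj-sym    : ∀ x y → adj x y ≡ adj y x
    adj-irrefl : ∀ x → adj x x ≡ false
open Graph public

Edge : ∀ {n} → Graph n → Fin n → Fin n → Set
Edge G x y = (vert G x ≡ true) × (vert G y ≡ true) × (adj G x y ≡ true)

IsPerfectMatching : ∀ {n} → Graph n → (Fin n → Fin n) → Set
IsPerfectMatching G m = ∀ x → vert G x ≡ true → Edge G x (m x) × (m (m x) ≡ x)

Matchable : ∀ {n} → Graph n → Set
Matchable {n} G = Σ (Fin n → Fin n) (IsPerfectMatching G)

data Walk {n} (G : Graph n) (B : VSet n) : Fin n → Fin n → Set where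
  here : ∀ {x} → vert G x ≡ true → B x ≡ false → Walk G B x x
  step : ∀ {x y z} → Edge G x y → B x ≡ false → Walk G B y z → Walk G B x z

noVerts : ∀ {n} → VSet n
noVerts _ = false

Connected : ∀ {n} → Graph n → Set
Connected G = ∀ x y → vert G x ≡ true → vert G y ≡ true → Walk G noVerts x y

MatchingCovered : ∀ {n} → Graph n → Set
MatchingCovered {n} G =
  Connected G × (2 ≤ count (vert G)) ×
  (∀ x y → Edge G x y → Σ (Fin n → Fin n) λ m → IsPerfectMatching G m × (m x ≡ y))

InGminusB : ∀ {n} → Graph n → VSet n → Fin n → Bool
InGminusB G B x = vert G x ∧ not (B x)

IsComponentLabelling : ∀ {n} → Graph n → VSet n → (k : ℕ) → (Fin n → Fin k) → Set
IsComponentLabelling {n} G B k c =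
  (∀ x y → InGminusB G B x ≡ true → InGminusB G B y ≡ true →
     (c x ≡ c y → Walk G B x y) × (Walk G B x y → c x ≡ c y)) ×
  (∀ i → Σ (Fin n) λ x → (InGminusB G B x ≡ true) × (c x ≡ i))

oddCount : ∀ {n} → Graph n → VSet n → (k : ℕ) → (Fin n → Fin k) → ℕ
oddCount G B k c =
  count {k} (λ i → (count (λ x → InGminusB G B x ∧ ⌊ c x ≟ i ⌋) % 2) ≡ᵇ 1)

OddComponentsEqual : ∀ {n} → Graph n → VSet n → ℕ → Set
OddComponentsEqual {n} G B t =
  Σ ℕ λ k → Σ (Fin n → Fin k) λ c → IsComponentLabelling G B k c × (oddCount G B k c ≡ t)

IsBarrier : ∀ {n} → Graph n → VSet n → Set
IsBarrier G B =
  Matchable G × (∀ x → B x ≡ true → vert G x ≡ true) ×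
  OddComponentsEqual G B (count B)

-- {u,v} is a 2-separation of G (G = G₁ ∪ G₂, V(G₁) = S₁, V(G₂) = S₂) and
-- Y = V(G₂) - v, so that D = ∂(Y) is a 2-separation cut with u ∈ Y, v ∉ Y.
-- (The roles of G₁,G₂ are existentially quantified, so this covers every
-- 2-separation cut arising from {u,v} with u ∈ Y, v ∈ Ȳ.)
TwoSepCut : ∀ {n} → Graph n → Fin n → Fin n → VSet n → Set
TwoSepCut {n} G u v Y =
  (u ≡ v → Data.Empty.⊥) ×
  Σ (VSet n) λ S₁ → Σ (VSet n) λ S₂ →
    (∀ x → S₁ x ≡ true → vert G x ≡ true) ×
    (∀ x → S₂ x ≡ true → vert G x ≡ true) ×
    (∀ x → vert G x ≡ true → (S₁ x ∨ S₂ x) ≡ true) ×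
    (∀ x → ((S₁ x ∧ S₂ x) ≡ true → (x ≡ u) ⊎ (x ≡ v)) ×
           ((x ≡ u) ⊎ (x ≡ v) → (S₁ x ∧ S₂ x) ≡ true)) ×
    (∀ x y → Edge G x y → ((S₁ x ∧ S₁ y) ∨ (S₂ x ∧ S₂ y)) ≡ true) ×
    (count S₁ % 2 ≡ 0) × (count S₂ % 2 ≡ 0) ×
    (∀ x → Y x ≡ (S₂ x ∧ not ⌊ x ≟ v ⌋))
  where import Data.Empty

-- G / (Ȳ → ȳ): vertices are 'suc x' for x ∈ Y, plus the new vertex ȳ = zero,
-- adjacent to x ∈ Y iff x has a neighbour in Ȳ = V(G) - Y.
contractAdj : ∀ {n} → Graph n → VSet n → Fin (suc n) → Fin (suc n) → Bool
contractAdj G Y zero    zero    = false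
contractAdj G Y zero    (suc y) = anyF (λ w → vert G w ∧ not (Y w) ∧ adj G y w)
contractAdj G Y (suc x) zero    = anyF (λ w → vert G w ∧ not (Y w) ∧ adj G x w)
contractAdj G Y (suc x) (suc y) = adj G x y

contractAdj-sym : ∀ {n} (G : Graph n) Y x y → contractAdj G Y x y ≡ contractAdj G Y y x
contractAdj-sym G Y zero    zero    = refl
contractAdj-sym G Y zero    (suc y) = refl
contractAdj-sym G Y (suc x) zero    = refl
contractAdj-sym G Y (suc x) (suc y) = adj-sym G x y

contractAdj-irrefl : ∀ {n} (G : Graph n) Y x → contractAdj G Y x x ≡ false
contractAdj-irrefl G Y zero    = refl
contractAdj-irrefl G Y (suc x) = adj-irrefl G x

contractVert : ∀ {n} → Graph n → VSet n → VSet (suc n)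
contractVert G Y zero    = true
contractVert G Y (suc x) = vert G x ∧ Y x

shrinkComplement : ∀ {n} → Graph n → VSet n → Graph (suc n)
shrinkComplement G Y = record
  { vert = contractVert G Y
  ; adj = contractAdj G Y
  ; adj-sym = contractAdj-sym G Y
  ; adj-irrefl = contractAdj-irrefl G Y }

-- Let G′ = G/(Ȳ → ȳ) and let B′ be B with ȳ replaced by v (or B itself when ȳ ∉ B);
-- |B′| = |B|.  Tutte's easy inequality o(G − B′) ≤ |B′| holds since G is matchable, so
-- it suffices to inject the odd components of G′ − B into those of G − B′.  Let s be ȳ
-- if ȳ ∉ B and u otherwise: every edge of ∂(Y) towards G − B′ then leaves Y from a vertex
-- joined to s in G′ − B.  A component of G′ − B avoiding s lies in Y and is a component
-- of G − B′ as well.  The component K of s corresponds to the union R of the components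
-- of G − B′ that meet Ȳ or reach s.  As Ȳ = S₁ − u has odd size, |Ȳ − B′| is odd
-- exactly when ȳ ∉ B, so R has the parity of K; an odd K thus has an odd component
-- inside R to be sent to.

module Submission where

open import Defs
open import Algebra.Properties.CommutativeMonoid.Sum as Sum using ()
open import Data.Bool using (Bool; true; false; _∧_; _∨_; not; _xor_; if_then_else_)
import Data.Bool as Bool
open import Data.Bool.Properties
  using (∧-conicalˡ; ∧-conicalʳ; ∨-conicalˡ; ∨-conicalʳ; ∧-zeroʳ; ∨-identityʳ;
         ∧-identityʳ; not-involutive; not-injective; not-distribˡ-xor; xor-comm)
open import Data.Empty using (⊥; ⊥-elim)
open import Data.Fin using (Fin; zero; suc; _≟_)
open import Data.Fin.Properties using (any?; suc-injective)
open import Data.Nat using (ℕ; zero; suc; pred; _+_; _%_; _≡ᵇ_; _≤_; z≤n; s≤s; s≤s⁻¹)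
open import Data.Nat.Properties
  using (≤-refl; ≤-trans; ≤-antisym; n≤1+n; n≤0⇒n≡0; +-0-commutativeMonoid)
open import Data.Product using (∃; _×_; _,_; proj₁; proj₂)
open import Data.Sum using (_⊎_; inj₁; inj₂)
open import Relation.Binary.PropositionalEquality
  using (_≡_; _≢_; _≗_; refl; sym; trans; cong; cong₂; subst; module ≡-Reasoning)
open import Relation.Nullary using (Dec; yes; no; ¬_)
open import Relation.Nullary.Decidable using (⌊_⌋; _×-dec_; map′)

open Sum +-0-commutativeMonoid using (sum; ∑-comm; ∑-distrib-+; sum-cong-≗; sum-replicate-zero)

true≢false : true ≢ false
true≢false ()

∧-intro : ∀ {a b} → a ≡ true → b ≡ true → a ∧ b ≡ true
∧-intro refl refl = refl

∨-false : ∀ {a b} → a ≡ false → b ≡ false → a ∨ b ≡ false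
∨-false refl refl = refl

∨-trueʳ : ∀ a {b} → b ≡ true → a ∨ b ≡ true
∨-trueʳ true  _ = refl
∨-trueʳ false p = p

true-or-false : (b : Bool) → b ≡ true ⊎ b ≡ false
true-or-false true  = inj₁ refl
true-or-false false = inj₂ refl

≡true-ext : ∀ {a b} → (a ≡ true → b ≡ true) → (b ≡ true → a ≡ true) → a ≡ b
≡true-ext {true}          f g = sym (f refl)
≡true-ext {false} {true}  f g = g refl
≡true-ext {false} {false} f g = refl

module _ {n : ℕ} where

  ⌊≟⌋-true : {x y : Fin n} → x ≡ y → ⌊ x ≟ y ⌋ ≡ true
  ⌊≟⌋-true {x} {y} p with x ≟ y
  ... | yes _ = refl
  ... | no q  = ⊥-elim (q p)

  ⌊≟⌋-false : {x y : Fin n} → x ≢ y → ⌊ x ≟ y ⌋ ≡ false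
  ⌊≟⌋-false {x} {y} p with x ≟ y
  ... | yes q = ⊥-elim (p q)
  ... | no _  = refl

  ⌊≟⌋-sound : {x y : Fin n} → ⌊ x ≟ y ⌋ ≡ true → x ≡ y
  ⌊≟⌋-sound {x} {y} p with x ≟ y
  ... | yes q = q

  ⌊≟⌋-false⁻¹ : {x y : Fin n} → ⌊ x ≟ y ⌋ ≡ false → x ≢ y
  ⌊≟⌋-false⁻¹ p q = true≢false (trans (sym (⌊≟⌋-true q)) p)

-- Counting and parity

indicator : Bool → ℕ
indicator b = if b then 1 else 0

count≡∑ : ∀ {n} (S : VSet n) → count S ≡ sum (λ x → indicator (S x))
count≡∑ {zero}  S = refl
count≡∑ {suc n} S = cong (indicator (S zero) +_) (count≡∑ (λ x → S (suc x)))

count-cong : ∀ {n} {S T : VSet n} → S ≗ T → count S ≡ count T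
count-cong {S = S} {T} S≗T = begin
  count S                        ≡⟨ count≡∑ S ⟩
  sum (λ x → indicator (S x))    ≡⟨ sum-cong-≗ (λ x → cong indicator (S≗T x)) ⟩
  sum (λ x → indicator (T x))    ≡⟨ count≡∑ T ⟨
  count T                        ∎
  where open ≡-Reasoning

count-empty : ∀ {n} (S : VSet n) → (∀ x → S x ≡ false) → count S ≡ 0
count-empty {zero}  S empty = refl
count-empty {suc n} S empty rewrite empty zero = count-empty (λ x → S (suc x)) (λ x → empty (suc x))

member? : ∀ {n} (S : VSet n) → (∃ λ x → S x ≡ true) ⊎ (∀ x → S x ≡ false)
member? S with any? (λ x → S x Bool.≟ true)
... | yes found = inj₁ found
... | no none   = inj₂ λ x → not-true (S x) (λ Sx → none (x , Sx))
  where
  not-true : ∀ b → ¬ b ≡ true → b ≡ false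
  not-true true  ¬t = ⊥-elim (¬t refl)
  not-true false _  = refl

count-suc⇒member : ∀ {n} (S : VSet n) {k} → count S ≡ suc k → ∃ λ x → S x ≡ true
count-suc⇒member S eq with member? S
... | inj₁ found = found
... | inj₂ empty with trans (sym (count-empty S empty)) eq
...   | ()

count-partition : ∀ {n} (S T : VSet n) →
  count S ≡ count (λ x → S x ∧ T x) + count (λ x → S x ∧ not (T x))
count-partition S T = begin
  count S
    ≡⟨ count≡∑ S ⟩
  sum (λ x → indicator (S x))
    ≡⟨ sum-cong-≗ (λ x → indicator-split (S x) (T x)) ⟩
  sum (λ x → indicator (S x ∧ T x) + indicator (S x ∧ not (T x)))
    ≡⟨ ∑-distrib-+ (λ x → indicator (S x ∧ T x)) (λ x → indicator (S x ∧ not (T x))) ⟩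
  sum (λ x → indicator (S x ∧ T x)) + sum (λ x → indicator (S x ∧ not (T x)))
    ≡⟨ cong₂ _+_ (count≡∑ (λ x → S x ∧ T x)) (count≡∑ (λ x → S x ∧ not (T x))) ⟨
  count (λ x → S x ∧ T x) + count (λ x → S x ∧ not (T x))
    ∎
  where
  open ≡-Reasoning
  indicator-split : ∀ a b → indicator a ≡ indicator (a ∧ b) + indicator (a ∧ not b)
  indicator-split true  true  = refl
  indicator-split true  false = refl
  indicator-split false _     = refl

∑-indicator-≟ : ∀ {k} (i : Fin k) b → sum (λ j → indicator (b ∧ ⌊ i ≟ j ⌋)) ≡ indicator b
∑-indicator-≟ {suc k} zero true  = cong suc (sum-replicate-zero k)
∑-indicator-≟ {suc k} zero false = sum-replicate-zero k
∑-indicator-≟ {suc k} (suc i) b = begin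
  indicator (b ∧ false) + sum (λ j → indicator (b ∧ ⌊ suc i ≟ suc j ⌋))
    ≡⟨ cong₂ _+_ (cong indicator (∧-zeroʳ b)) (sum-cong-≗ (λ j → cong (λ t → indicator (b ∧ t)) (⌊suc≟suc⌋ j))) ⟩
  sum (λ j → indicator (b ∧ ⌊ i ≟ j ⌋))
    ≡⟨ ∑-indicator-≟ i b ⟩
  indicator b
    ∎
  where
  open ≡-Reasoning
  ⌊suc≟suc⌋ : ∀ j → ⌊ suc i ≟ suc j ⌋ ≡ ⌊ i ≟ j ⌋
  ⌊suc≟suc⌋ j with i ≟ j
  ... | yes _ = refl
  ... | no _  = refl

count-fibres : ∀ {n k} (S : VSet n) (c : Fin n → Fin k) →
  count S ≡ sum (λ j → count (λ x → S x ∧ ⌊ c x ≟ j ⌋))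
count-fibres S c = begin
  count S
    ≡⟨ count≡∑ S ⟩
  sum (λ x → indicator (S x))
    ≡⟨ sum-cong-≗ (λ x → ∑-indicator-≟ (c x) (S x)) ⟨
  sum (λ x → sum (λ j → indicator (S x ∧ ⌊ c x ≟ j ⌋)))
    ≡⟨ ∑-comm (λ x j → indicator (S x ∧ ⌊ c x ≟ j ⌋)) ⟩
  sum (λ j → sum (λ x → indicator (S x ∧ ⌊ c x ≟ j ⌋)))
    ≡⟨ sum-cong-≗ (λ j → count≡∑ (λ x → S x ∧ ⌊ c x ≟ j ⌋)) ⟨
  sum (λ j → count (λ x → S x ∧ ⌊ c x ≟ j ⌋))
    ∎
  where open ≡-Reasoning

count-singleton : ∀ {n} (S : VSet n) a → S a ≡ true → count (λ x → S x ∧ ⌊ x ≟ a ⌋) ≡ 1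
count-singleton S a Sa = begin
  count (λ x → S x ∧ ⌊ x ≟ a ⌋)              ≡⟨ count-cong only-a ⟩
  count (λ x → S a ∧ ⌊ a ≟ x ⌋)              ≡⟨ count≡∑ (λ x → S a ∧ ⌊ a ≟ x ⌋) ⟩
  sum (λ x → indicator (S a ∧ ⌊ a ≟ x ⌋))    ≡⟨ ∑-indicator-≟ a (S a) ⟩
  indicator (S a)                            ≡⟨ cong indicator Sa ⟩
  1                                          ∎
  where
  open ≡-Reasoning
  only-a : ∀ x → (S x ∧ ⌊ x ≟ a ⌋) ≡ (S a ∧ ⌊ a ≟ x ⌋)
  only-a x with x ≟ a
  ... | yes refl rewrite ⌊≟⌋-true {x = a} refl = refl
  ... | no x≢a   rewrite ⌊≟⌋-false (λ a≡x → x≢a (sym a≡x)) = trans (∧-zeroʳ (S x)) (sym (∧-zeroʳ (S a)))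

remove : ∀ {n} → Fin n → VSet n → VSet n
remove a S x = S x ∧ not ⌊ x ≟ a ⌋

count-remove : ∀ {n} (S : VSet n) a → S a ≡ true → count S ≡ suc (count (remove a S))
count-remove S a Sa =
  trans (count-partition S (λ x → ⌊ x ≟ a ⌋)) (cong (_+ count (remove a S)) (count-singleton S a Sa))

remove-≢ : ∀ {n} (S : VSet n) {a x} → remove a S x ≡ true → x ≢ a
remove-≢ S {x = x} p = ⌊≟⌋-false⁻¹ (not-injective (∧-conicalʳ (S x) _ p))

remove-intro : ∀ {n} (S : VSet n) {a x} → S x ≡ true → x ≢ a → remove a S x ≡ true
remove-intro S Sx x≢a = ∧-intro Sx (cong not (⌊≟⌋-false x≢a))

count≥2⇒distinct-members : ∀ {n} (S : VSet n) → 2 ≤ count S →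
  ∃ λ x → ∃ λ y → S x ≡ true × S y ≡ true × x ≢ y
count≥2⇒distinct-members S 2≤|S| with count S in |S|≡ | 2≤|S|
... | suc zero    | s≤s ()
... | suc (suc k) | _ = x , y , Sx , ∧-conicalˡ _ _ y∈ , λ x≡y → remove-≢ S y∈ (sym x≡y)
  where
  x-member = count-suc⇒member S |S|≡
  x  = proj₁ x-member
  Sx = proj₂ x-member
  y-member = count-suc⇒member (remove x S) (cong pred (trans (sym (count-remove S x Sx)) |S|≡))
  y  = proj₁ y-member
  y∈ = proj₂ y-member

isOdd : ℕ → Bool
isOdd zero    = false
isOdd (suc n) = not (isOdd n)

isOdd-+ : ∀ m n → isOdd (m + n) ≡ isOdd m xor isOdd n
isOdd-+ zero    n = refl
isOdd-+ (suc m) n = trans (cong not (isOdd-+ m n)) (not-distribˡ-xor (isOdd m) (isOdd n))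

%2≡ᵇ1≡isOdd : ∀ n → (n % 2 ≡ᵇ 1) ≡ isOdd n
%2≡ᵇ1≡isOdd zero          = refl
%2≡ᵇ1≡isOdd (suc zero)    = refl
%2≡ᵇ1≡isOdd (suc (suc n)) = trans (%2≡ᵇ1≡isOdd n) (sym (not-involutive (isOdd n)))

isOdd⇒nonzero : ∀ m → isOdd m ≡ true → ∃ λ k → m ≡ suc k
isOdd⇒nonzero (suc m) _ = m , refl

∑-odd⇒odd-term : ∀ {k} (f : Fin k → ℕ) → isOdd (sum f) ≡ true → ∃ λ j → isOdd (f j) ≡ true
∑-odd⇒odd-term {suc k} f odd with isOdd (f zero) in f₀-odd
... | true  = zero , f₀-odd
... | false =
  let j , fj-odd = ∑-odd⇒odd-term (λ j → f (suc j))
                     (trans (cong (_xor isOdd (sum (λ j → f (suc j)))) (sym f₀-odd)) (trans (sym (isOdd-+ (f zero) _)) odd))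
  in suc j , fj-odd

count-≤-injection : ∀ {k m} (P : VSet k) (Q : VSet m) (f : ∀ i → P i ≡ true → Fin m) →
  (∀ i p → Q (f i p) ≡ true) → (∀ i j p q → f i p ≡ f j q → i ≡ j) → count P ≤ count Q
count-≤-injection {zero}  P Q f into inj = z≤n
count-≤-injection {suc k} P Q f into inj with P zero in P₀
... | false = count-≤-injection (λ i → P (suc i)) Q (λ i → f (suc i)) (λ i → into (suc i))
                (λ i j p q eq → suc-injective (inj (suc i) (suc j) p q eq))
... | true  = subst (suc (count (λ i → P (suc i))) ≤_) (sym (count-remove Q f₀ (into zero P₀)))
                (s≤s (count-≤-injection (λ i → P (suc i)) (remove f₀ Q) (λ i → f (suc i)) into-rest
                        (λ i j p q eq → suc-injective (inj (suc i) (suc j) p q eq))))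
  where
  f₀ = f zero P₀
  into-rest : ∀ i p → remove f₀ Q (f (suc i) p) ≡ true
  into-rest i p = remove-intro Q (into (suc i) p) (λ eq → 0≢1+n (sym (inj (suc i) zero p P₀ eq)))
    where 0≢1+n : ∀ {k} {i : Fin k} → zero ≢ suc i
          0≢1+n ()

module _ {n} (m : Fin n → Fin n) where

  PairedBy : VSet n → Set
  PairedBy S = ∀ x → S x ≡ true → S (m x) ≡ true × m (m x) ≡ x × m x ≢ x

  pairedBy⇒even : ∀ S → PairedBy S → isOdd (count S) ≡ false
  pairedBy⇒even S = by-fuel (count S) S ≤-refl
    where
    by-fuel : ∀ f S → count S ≤ f → PairedBy S → isOdd (count S) ≡ false
    by-fuel zero    S bound paired = cong isOdd (n≤0⇒n≡0 bound)
    by-fuel (suc f) S bound paired with member? S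
    ... | inj₂ empty    = cong isOdd (count-empty S empty)
    ... | inj₁ (a , Sa) = begin
      isOdd (count S)                    ≡⟨ cong isOdd count-S ⟩
      not (not (isOdd (count S⁻)))        ≡⟨ not-involutive _ ⟩
      isOdd (count S⁻)                    ≡⟨ by-fuel f S⁻ bound⁻ paired⁻ ⟩
      false                              ∎
      where
      open ≡-Reasoning
      ma∈ = paired a Sa
      Sma : remove a S (m a) ≡ true
      Sma = remove-intro S (proj₁ ma∈) (proj₂ (proj₂ ma∈))
      S⁻ = remove (m a) (remove a S)
      count-S : count S ≡ suc (suc (count S⁻))
      count-S = trans (count-remove S a Sa) (cong suc (count-remove (remove a S) (m a) Sma))
      bound⁻ : count S⁻ ≤ f
      bound⁻ = ≤-trans (n≤1+n _) (s≤s⁻¹ (subst (_≤ suc f) count-S bound))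
      paired⁻ : PairedBy S⁻
      paired⁻ x x∈ = remove-intro (remove a S) (remove-intro S Smx mx≢a) mx≢ma , mmx≡x , proj₂ (proj₂ x∈S)
        where
        x≢ma = remove-≢ (remove a S) x∈
        x≢a  = remove-≢ S (∧-conicalˡ _ _ x∈)
        Sx   = ∧-conicalˡ _ _ (∧-conicalˡ _ _ x∈)
        x∈S  = paired x Sx
        Smx  = proj₁ x∈S
        mmx≡x = proj₁ (proj₂ x∈S)
        mx≢a : m x ≢ a
        mx≢a mx≡a = x≢ma (trans (sym mmx≡x) (cong m mx≡a))
        mx≢ma : m x ≢ m a
        mx≢ma mx≡ma = x≢a (trans (sym mmx≡x) (trans (cong m mx≡ma) (proj₁ (proj₂ ma∈))))

-- Walks

insert : ∀ {n} → Fin n → VSet n → VSet n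
insert a S x = S x ∨ ⌊ x ≟ a ⌋

module _ {n} (G : Graph n) where

  edge-sym : ∀ {x y} → Edge G x y → Edge G y x
  edge-sym (x∈ , y∈ , xy) = y∈ , x∈ , trans (adj-sym G _ _) xy

  InGminusB-intro : ∀ B {x} → vert G x ≡ true → B x ≡ false → InGminusB G B x ≡ true
  InGminusB-intro B x∈ x∉B = ∧-intro x∈ (cong not x∉B)

  InGminusB-vert : ∀ B x → InGminusB G B x ≡ true → vert G x ≡ true
  InGminusB-vert B x = ∧-conicalˡ (vert G x) _

  InGminusB-∉ : ∀ B x → InGminusB G B x ≡ true → B x ≡ false
  InGminusB-∉ B x p = not-injective (∧-conicalʳ (vert G x) _ p)

  trivial-walk : ∀ {B x} → InGminusB G B x ≡ true → Walk G B x x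
  trivial-walk {B} {x} p = here (InGminusB-vert B x p) (InGminusB-∉ B x p)

module _ {n} {G : Graph n} where

  walk-source : ∀ {B a b} → Walk G B a b → InGminusB G B a ≡ true
  walk-source {B} (here a∈ a∉B)   = InGminusB-intro G B a∈ a∉B
  walk-source {B} (step ab a∉B _) = InGminusB-intro G B (proj₁ ab) a∉B

  walk-target : ∀ {B a b} → Walk G B a b → InGminusB G B b ≡ true
  walk-target {B} (here b∈ b∉B) = InGminusB-intro G B b∈ b∉B
  walk-target (step _ _ w)      = walk-target w

  infixr 5 _++ʷ_
  _++ʷ_ : ∀ {B a b c} → Walk G B a b → Walk G B b c → Walk G B a c
  here _ _     ++ʷ w′ = w′
  step e a∉B w ++ʷ w′ = step e a∉B (w ++ʷ w′)

  reverse : ∀ {B a b} → Walk G B a b → Walk G B b a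
  reverse w = go w (trivial-walk G (walk-source w))
    where
    go : ∀ {B a b c} → Walk G B a b → Walk G B a c → Walk G B b c
    go (here _ _)       acc = acc
    go {B} (step e _ w) acc = go w (step (edge-sym G e) (InGminusB-∉ G B _ (walk-source w)) acc)

  walk-mono : ∀ {B B′ a b} → (∀ z → B′ z ≡ false → B z ≡ false) → Walk G B′ a b → Walk G B a b
  walk-mono B⊆B′ (here a∈ a∉B)  = here a∈ (B⊆B′ _ a∉B)
  walk-mono B⊆B′ (step e a∉B w) = step e (B⊆B′ _ a∉B) (walk-mono B⊆B′ w)

  walk-insert⁻ : ∀ {B z a b} → Walk G (insert z B) a b → Walk G B a b
  walk-insert⁻ {B} = walk-mono (λ x → ∨-conicalˡ (B x) _)

  walk-avoiding : ∀ {B a b z} → Walk G B a b → ¬ Walk G B a z → Walk G (insert z B) a b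
  walk-avoiding (here a∈ a∉B) ¬a⇝z =
    here a∈ (∨-false a∉B (⌊≟⌋-false λ { refl → ¬a⇝z (here a∈ a∉B) }))
  walk-avoiding (step e a∉B w) ¬a⇝z =
    step e (∨-false a∉B (⌊≟⌋-false λ { refl → ¬a⇝z (here (proj₁ e) a∉B) }))
           (walk-avoiding w (λ w′ → ¬a⇝z (step e a∉B w′)))

  last-exit : ∀ {B a b} → Walk G B a b → ∀ x → x ≢ b →
    Walk G (insert x B) a b ⊎ ∃ λ w → Edge G x w × Walk G (insert x B) w b
  last-exit (here b∈ b∉B) x x≢b = inj₁ (here b∈ (∨-false b∉B (⌊≟⌋-false (λ b≡x → x≢b (sym b≡x)))))
  last-exit {a = a} (step e a∉B w) x x≢b with last-exit w x x≢b
  ... | inj₂ exit = inj₂ exit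
  ... | inj₁ w′ with a ≟ x
  ...   | yes refl = inj₂ (_ , e , w′)
  ...   | no a≢x   = inj₁ (step e (∨-false a∉B (⌊≟⌋-false a≢x)) w′)

module _ {n} (G : Graph n) where

  edge? : ∀ x y → Dec (Edge G x y)
  edge? x y = (vert G x Bool.≟ true) ×-dec (vert G y Bool.≟ true) ×-dec (adj G x y Bool.≟ true)

  walk? : ∀ B x y → Dec (Walk G B x y)
  walk? B = by-fuel (count (InGminusB G B)) B ≤-refl
    where
    InGminusB-insert : ∀ B x → InGminusB G (insert x B) ≗ remove x (InGminusB G B)
    InGminusB-insert B x z with vert G z | B z | ⌊ z ≟ x ⌋
    ... | true  | true  | _     = refl
    ... | true  | false | true  = refl
    ... | true  | false | false = refl
    ... | false | _     | _     = refl

    by-fuel : ∀ f B → count (InGminusB G B) ≤ f → ∀ x y → Dec (Walk G B x y)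
    by-fuel f B bound x y with true-or-false (InGminusB G B x)
    ... | inj₂ x∉ = no λ w → true≢false (trans (sym (walk-source w)) x∉)
    ... | inj₁ x∈ with x ≟ y
    ...   | yes refl = yes (trivial-walk G x∈)
    ...   | no x≢y with f
    ...     | zero   = ⊥-elim (1+n≰0 (subst (_≤ 0) (count-remove _ x x∈) bound))
      where 1+n≰0 : ∀ {k} → suc k ≤ 0 → ⊥
            1+n≰0 ()
    ...     | suc f′ = map′ leave-x via-last-exit (any? λ w → edge? x w ×-dec by-fuel f′ (insert x B) bound′ w y)
      where
      bound′ : count (InGminusB G (insert x B)) ≤ f′
      bound′ = s≤s⁻¹ (subst (_≤ suc f′) (trans (count-remove _ x x∈) (cong suc (sym (count-cong (InGminusB-insert B x))))) bound)
      leave-x : (∃ λ w → Edge G x w × Walk G (insert x B) w y) → Walk G B x y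
      leave-x (w , e , w⇝y) = step e (InGminusB-∉ G B x x∈) (walk-insert⁻ w⇝y)
      via-last-exit : Walk G B x y → ∃ λ w → Edge G x w × Walk G (insert x B) w y
      via-last-exit w with last-exit w x x≢y
      ... | inj₂ exit = exit
      ... | inj₁ w′   = ⊥-elim (true≢false (trans (sym (∨-trueʳ (B x) (⌊≟⌋-true {x = x} refl)))
                                                   (InGminusB-∉ G (insert x B) x (walk-source w′))))

walk-first-edge : ∀ {n} {G : Graph n} {B a b} → Walk G B a b → a ≢ b → ∃ λ w → Edge G a w
walk-first-edge (here _ _)   a≢a = ⊥-elim (a≢a refl)
walk-first-edge (step e _ _) _   = _ , e

-- Component labellings

IsClassLabelling : ∀ {n} → VSet n → (Fin n → Fin n → Set) → (k : ℕ) → (Fin n → Fin k) → Set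
IsClassLabelling {n} D R k c =
  (∀ x y → D x ≡ true → D y ≡ true → (c x ≡ c y → R x y) × (R x y → c x ≡ c y)) ×
  (∀ i → ∃ λ x → D x ≡ true × c x ≡ i)

record IsEquivalenceOn {n} (D : VSet n) (R : Fin n → Fin n → Set) : Set where
  field
    decide     : ∀ x y → Dec (R x y)
    domain     : ∀ {x y} → R x y → D x ≡ true
    reflexive  : ∀ {x} → D x ≡ true → R x x
    symmetric  : ∀ {x y} → R x y → R y x
    transitive : ∀ {x y z} → R x y → R y z → R x z

restrict : ∀ {n} {D : VSet (suc n)} {R} → IsEquivalenceOn D R →
  IsEquivalenceOn (λ x → D (suc x)) (λ x y → R (suc x) (suc y))
restrict eqv = record
  { decide = λ x y → decide (suc x) (suc y) ; domain = domain ; reflexive = reflexive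
  ; symmetric = symmetric ; transitive = transitive }
  where open IsEquivalenceOn eqv

classLabelling : ∀ {n} {D : VSet n} {R} → IsEquivalenceOn D R →
  (∀ x → D x ≡ false) ⊎ ∃ λ k → ∃ λ c → IsClassLabelling D R (suc k) c
classLabelling {zero} _ = inj₁ λ ()
classLabelling {suc n} {D} {R} eqv with classLabelling (restrict eqv) | true-or-false (D zero)
... | inj₁ empty | inj₂ D₀ = inj₁ λ { zero → D₀ ; (suc x) → empty x }
... | inj₁ empty | inj₁ D₀ = inj₂ (0 , (λ _ → zero) , classes , λ { zero → zero , D₀ , refl })
  where
  open IsEquivalenceOn eqv
  classes : ∀ x y → D x ≡ true → D y ≡ true → _
  classes zero    zero    _  _  = (λ _ → reflexive D₀) , λ _ → refl
  classes (suc x) _       Dx _  = ⊥-elim (true≢false (trans (sym Dx) (empty x)))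
  classes zero    (suc y) _  Dy = ⊥-elim (true≢false (trans (sym Dy) (empty y)))
... | inj₂ (k , c , classes , onto) | inj₂ D₀ = inj₂ (k , c′ , classes′ , onto′)
  where
  c′ : Fin (suc n) → Fin (suc k)
  c′ zero    = zero
  c′ (suc x) = c x
  classes′ : ∀ x y → D x ≡ true → D y ≡ true → _
  classes′ zero    _       D0 _  = ⊥-elim (true≢false (trans (sym D0) D₀))
  classes′ (suc x) zero    _  D0 = ⊥-elim (true≢false (trans (sym D0) D₀))
  classes′ (suc x) (suc y) Dx Dy = classes x y Dx Dy
  onto′ : ∀ i → _
  onto′ i = let (x , Dx , cx) = onto i in suc x , Dx , cx
... | inj₂ (k , c , classes , onto) | inj₁ D₀ with any? (λ x → IsEquivalenceOn.decide eqv zero (suc x))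
...   | yes (x₀ , R0x₀) = inj₂ (k , c′ , classes′ , onto′)
  where
  open IsEquivalenceOn eqv
  Dx₀ = domain (symmetric R0x₀)
  c′ : Fin (suc n) → Fin (suc k)
  c′ zero    = c x₀
  c′ (suc x) = c x
  classes′ : ∀ x y → D x ≡ true → D y ≡ true → (c′ x ≡ c′ y → R x y) × (R x y → c′ x ≡ c′ y)
  classes′ zero    zero    _  _  = (λ _ → reflexive D₀) , λ _ → refl
  classes′ zero    (suc y) _  Dy = (λ eq → transitive R0x₀ (proj₁ (classes x₀ y Dx₀ Dy) eq))
                                 , (λ R0y → proj₂ (classes x₀ y Dx₀ Dy) (transitive (symmetric R0x₀) R0y))
  classes′ (suc x) zero    Dx _  = (λ eq → symmetric (proj₁ (classes′ zero (suc x) D₀ Dx) (sym eq)))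
                                 , (λ Rx0 → sym (proj₂ (classes′ zero (suc x) D₀ Dx) (symmetric Rx0)))
  classes′ (suc x) (suc y) Dx Dy = classes x y Dx Dy
  onto′ : ∀ i → _
  onto′ i = let (x , Dx , cx) = onto i in suc x , Dx , cx
...   | no ¬R0x = inj₂ (suc k , c′ , classes′ , onto′)
  where
  open IsEquivalenceOn eqv
  c′ : Fin (suc n) → Fin (suc (suc k))
  c′ zero    = zero
  c′ (suc x) = suc (c x)
  classes′ : ∀ x y → D x ≡ true → D y ≡ true → (c′ x ≡ c′ y → R x y) × (R x y → c′ x ≡ c′ y)
  classes′ zero    zero    _  _  = (λ _ → reflexive D₀) , λ _ → refl
  classes′ zero    (suc y) _  _  = (λ ()) , λ R0y → ⊥-elim (¬R0x (y , R0y))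
  classes′ (suc x) zero    _  _  = (λ ()) , λ Rx0 → ⊥-elim (¬R0x (x , symmetric Rx0))
  classes′ (suc x) (suc y) Dx Dy = (λ eq → proj₁ (classes x y Dx Dy) (suc-injective eq))
                                 , (λ Rxy → cong suc (proj₂ (classes x y Dx Dy) Rxy))
  onto′ : ∀ i → _
  onto′ zero    = zero , D₀ , refl
  onto′ (suc i) = let (x , Dx , cx) = onto i in suc x , Dx , cong suc cx

componentLabelling : ∀ {n} (G : Graph n) (B : VSet n) → (∃ λ w → InGminusB G B w ≡ true) →
  ∃ λ k → ∃ λ c → IsComponentLabelling G B k c
componentLabelling G B (w , w∈) with classLabelling walks
  where
  walks : IsEquivalenceOn (InGminusB G B) (Walk G B)
  walks = record
    { decide = walk? G B ; domain = walk-source ; reflexive = trivial-walk G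
    ; symmetric = reverse ; transitive = _++ʷ_ }
... | inj₁ empty           = ⊥-elim (true≢false (trans (sym w∈) (empty w)))
... | inj₂ (k , c , lab)  = suc k , c , lab

module Labelling {n} {G : Graph n} {B : VSet n} {k c} (lab : IsComponentLabelling G B k c) where

  connect : ∀ {x y} → InGminusB G B x ≡ true → InGminusB G B y ≡ true → c x ≡ c y → Walk G B x y
  connect x∈ y∈ = proj₁ (proj₁ lab _ _ x∈ y∈)

  same-label : ∀ {x y} → Walk G B x y → c x ≡ c y
  same-label w = proj₂ (proj₁ lab _ _ (walk-source w) (walk-target w)) w

  rep : Fin k → Fin n
  rep i = proj₁ (proj₂ lab i)

  rep-∈ : ∀ i → InGminusB G B (rep i) ≡ true
  rep-∈ i = proj₁ (proj₂ (proj₂ lab i))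

  rep-label : ∀ i → c (rep i) ≡ i
  rep-label i = proj₂ (proj₂ (proj₂ lab i))

-- Tutte's inequality

component : ∀ {n k} (G : Graph n) (B : VSet n) → (Fin n → Fin k) → Fin k → VSet n
component G B c i x = InGminusB G B x ∧ ⌊ c x ≟ i ⌋

module _ {n k} (G : Graph n) (B : VSet n) (c : Fin n → Fin k) {i : Fin k} {x : Fin n} where

  component-∈ : component G B c i x ≡ true → InGminusB G B x ≡ true
  component-∈ = ∧-conicalˡ _ _

  component-label : component G B c i x ≡ true → c x ≡ i
  component-label p = ⌊≟⌋-sound (∧-conicalʳ (InGminusB G B x) _ p)

  component-intro : InGminusB G B x ≡ true → c x ≡ i → component G B c i x ≡ true
  component-intro x∈ cx≡i = ∧-intro x∈ (⌊≟⌋-true cx≡i)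

oddLabels : ∀ {n k} (G : Graph n) (B : VSet n) → (Fin n → Fin k) → VSet k
oddLabels G B c i = count (component G B c i) % 2 ≡ᵇ 1

oddLabels≡isOdd : ∀ {n k} (G : Graph n) (B : VSet n) (c : Fin n → Fin k) i →
  oddLabels G B c i ≡ isOdd (count (component G B c i))
oddLabels≡isOdd G B c i = %2≡ᵇ1≡isOdd (count (component G B c i))

module _ {n} (G : Graph n) (B : VSet n) {m} (perfect : IsPerfectMatching G m) where

  matched-edge : ∀ {x} → vert G x ≡ true → Edge G x (m x)
  matched-edge x∈ = proj₁ (perfect _ x∈)

  matched-involutive : ∀ {x} → vert G x ≡ true → m (m x) ≡ x
  matched-involutive x∈ = proj₂ (perfect _ x∈)

  module _ {k} (c : Fin n → Fin k) (lab : IsComponentLabelling G B k c) where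

    odd-component-matched-into-B : ∀ i → oddLabels G B c i ≡ true →
      ∃ λ x → component G B c i x ≡ true × B (m x) ≡ true
    odd-component-matched-into-B i odd with member? (λ x → component G B c i x ∧ B (m x))
    ... | inj₁ (x , p) = x , ∧-conicalˡ _ _ p , ∧-conicalʳ (component G B c i x) _ p
    ... | inj₂ none    = ⊥-elim (true≢false (trans (sym odd)
                           (trans (oddLabels≡isOdd G B c i) (pairedBy⇒even m (component G B c i) paired))))
      where
      paired : PairedBy m (component G B c i)
      paired x x∈C = mx∈C , matched-involutive x∈ , mx≢x
        where
        x∈G-B = component-∈ G B c x∈C
        x∈ = InGminusB-vert G B x x∈G-B
        e = matched-edge x∈
        mx∉B : B (m x) ≡ false
        mx∉B = subst (λ b → b ∧ B (m x) ≡ false) x∈C (none x)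
        mx∈G-B = InGminusB-intro G B (proj₁ (proj₂ e)) mx∉B
        same : c x ≡ c (m x)
        same = Labelling.same-label lab (step e (InGminusB-∉ G B x x∈G-B) (trivial-walk G mx∈G-B))
        mx∈C = component-intro G B c mx∈G-B (trans (sym same) (component-label G B c x∈C))
        mx≢x : m x ≢ x
        mx≢x mx≡x = true≢false (trans (sym (proj₂ (proj₂ e))) (trans (cong (adj G x) mx≡x) (adj-irrefl G x)))

    oddCount≤count : oddCount G B k c ≤ count B
    oddCount≤count = count-≤-injection (oddLabels G B c) B partner partner∈B partner-injective
      where
      witness = odd-component-matched-into-B
      partner : ∀ i → oddLabels G B c i ≡ true → Fin n
      partner i odd = m (proj₁ (witness i odd))
      partner∈B : ∀ i odd → B (partner i odd) ≡ true
      partner∈B i odd = proj₂ (proj₂ (witness i odd))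
      label : ∀ i odd → c (proj₁ (witness i odd)) ≡ i
      label i odd = component-label G B c (proj₁ (proj₂ (witness i odd)))
      in-G : ∀ i odd → vert G (proj₁ (witness i odd)) ≡ true
      in-G i odd = InGminusB-vert G B _ (component-∈ G B c (proj₁ (proj₂ (witness i odd))))
      partner-injective : ∀ i j odd odd′ → partner i odd ≡ partner j odd′ → i ≡ j
      partner-injective i j odd odd′ eq = begin
        i                            ≡⟨ label i odd ⟨
        c (proj₁ (witness i odd))    ≡⟨ cong c (trans (sym (matched-involutive (in-G i odd)))
                                                      (trans (cong m eq) (matched-involutive (in-G j odd′)))) ⟩
        c (proj₁ (witness j odd′))   ≡⟨ label j odd′ ⟩
        j                            ∎
        where open ≡-Reasoning

matchingCovered⇒matchable : ∀ {n} (G : Graph n) → MatchingCovered G → Matchable G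
matchingCovered⇒matchable G (connected , 2≤|V| , covered) =
  let x , y , x∈ , y∈ , x≢y = count≥2⇒distinct-members (vert G) 2≤|V|
      w , xw               = walk-first-edge (connected x y x∈ y∈) x≢y
      m , perfect , _      = covered x w xw
  in m , perfect

-- Shrinking the complement of Y

edge-to-ȳ : ∀ {n} (G : Graph n) (Y : VSet n) {a b} → Edge G a b → Y a ≡ true → Y b ≡ false →
  Edge (shrinkComplement G Y) (suc a) zero
edge-to-ȳ G Y {a} {b} (a∈ , b∈ , ab) Ya ¬Yb =
  ∧-intro a∈ Ya , refl , anyF-intro (λ w → vert G w ∧ not (Y w) ∧ adj G a w) b (∧-intro b∈ (∧-intro (cong not ¬Yb) ab))
  where
  anyF-intro : ∀ {m} (S : VSet m) x → S x ≡ true → anyF S ≡ true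
  anyF-intro S zero    Sx rewrite Sx = refl
  anyF-intro S (suc x) Sx with S zero
  ... | true  = refl
  ... | false = anyF-intro (λ y → S (suc y)) x Sx

module ContractionComparison {n} (G : Graph n) (Y : VSet n) (B : VSet (suc n)) (B′ : VSet n)
  (s : Fin (suc n))
  (B′-agrees : ∀ a → Y a ≡ true → B′ a ≡ B (suc a))
  (ȳ-is-s : InGminusB (shrinkComplement G Y) B zero ≡ true → s ≡ zero)
  (crossing-reaches-s : ∀ a b → Edge G a b → Y a ≡ true → Y b ≡ false → B (suc a) ≡ false →
     InGminusB G B′ b ≡ true → Walk (shrinkComplement G Y) B (suc a) s)
  (outside-parity :
     isOdd (count (λ w → InGminusB G B′ w ∧ not (Y w))) ≡ InGminusB (shrinkComplement G Y) B zero)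
  where

  G′ = shrinkComplement G Y

  lift-vertex : ∀ a → InGminusB G′ B (suc a) ≡ true → InGminusB G B′ a ≡ true × Y a ≡ true
  lift-vertex a a∈ = InGminusB-intro G B′ (∧-conicalˡ _ _ a∈G) (trans (B′-agrees a Ya) (InGminusB-∉ G′ B (suc a) a∈)) , Ya
    where
    a∈G = InGminusB-vert G′ B (suc a) a∈
    Ya  = ∧-conicalʳ (vert G a) _ a∈G

  ∉B′⇒∉B : ∀ {a} → Y a ≡ true → B′ a ≡ false → B (suc a) ≡ false
  ∉B′⇒∉B {a} Ya = trans (sym (B′-agrees a Ya))

  lift-edge : ∀ {a b} → Edge G a b → Y a ≡ true → Y b ≡ true → Edge G′ (suc a) (suc b)
  lift-edge (a∈ , b∈ , ab) Ya Yb = ∧-intro a∈ Ya , ∧-intro b∈ Yb , ab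

  lift-walk : ∀ {a b} → Walk G B′ a b → Y a ≡ true →
    (Y b ≡ true × Walk G′ B (suc a) (suc b)) ⊎ Walk G′ B (suc a) s
  lift-walk (here a∈ a∉B′) Ya = inj₁ (Ya , here (∧-intro a∈ Ya) (∉B′⇒∉B Ya a∉B′))
  lift-walk {a} (step {y = a₁} e a∉B′ w) Ya with true-or-false (Y a₁)
  ... | inj₂ ¬Ya₁ = inj₂ (crossing-reaches-s a a₁ e Ya ¬Ya₁ (∉B′⇒∉B Ya a∉B′) (walk-source w))
  ... | inj₁ Ya₁ with lift-walk w Ya₁
  ...   | inj₁ (Yb , w′) = inj₁ (Yb , step (lift-edge e Ya Ya₁) (∉B′⇒∉B Ya a∉B′) w′)
  ...   | inj₂ w′        = inj₂ (step (lift-edge e Ya Ya₁) (∉B′⇒∉B Ya a∉B′) w′)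

  ȳ-avoided : ∀ {b} → ¬ Walk G′ (insert s B) zero b
  ȳ-avoided w = true≢false (trans (sym (∨-trueʳ (B zero) (⌊≟⌋-true (sym (ȳ-is-s ȳ∈′)))))
                               (InGminusB-∉ G′ (insert s B) zero ȳ∈))
    where
    ȳ∈  = walk-source w
    ȳ∈′ = InGminusB-intro G′ B refl (∨-conicalˡ (B zero) _ (InGminusB-∉ G′ (insert s B) zero ȳ∈))

  project-walk : ∀ {a b} → Walk G′ (insert s B) (suc a) (suc b) → Walk G B′ a b
  project-walk {a} (here a∈ a∉) =
    here (∧-conicalˡ _ _ a∈) (trans (B′-agrees a (∧-conicalʳ (vert G a) _ a∈)) (∨-conicalˡ _ _ a∉))
  project-walk {a} (step {y = zero} e a∉ w) = ⊥-elim (ȳ-avoided w)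
  project-walk {a} (step {y = suc a₁} (a∈ , a₁∈ , aa₁) a∉ w) =
    step (∧-conicalˡ _ _ a∈ , ∧-conicalˡ _ _ a₁∈ , aa₁)
         (trans (B′-agrees a (∧-conicalʳ (vert G a) _ a∈)) (∨-conicalˡ _ _ a∉)) (project-walk w)

  Reaches : Fin (suc n) → Set
  Reaches p = Walk G′ B p s

  reaches? : Fin (suc n) → Bool
  reaches? p = ⌊ walk? G′ B p s ⌋

  reaches?-complete : ∀ {p} → Reaches p → reaches? p ≡ true
  reaches?-complete {p} r with walk? G′ B p s
  ... | yes _ = refl
  ... | no ¬r = ⊥-elim (¬r r)

  reaches?-sound : ∀ {p} → reaches? p ≡ true → Reaches p
  reaches?-sound {p} t with walk? G′ B p s
  ... | yes r = r

  ȳ-reaches : InGminusB G′ B zero ≡ true → Reaches zero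
  ȳ-reaches ȳ∈ = subst (Walk G′ B zero) (sym (ȳ-is-s ȳ∈)) (trivial-walk G′ ȳ∈)

  sComponent : VSet (suc n)
  sComponent p = InGminusB G′ B p ∧ reaches? p

  sPreimage : VSet n
  sPreimage w = InGminusB G B′ w ∧ (not (Y w) ∨ reaches? (suc w))

  isOdd-sPreimage : isOdd (count sPreimage) ≡ isOdd (count sComponent)
  isOdd-sPreimage = begin
    isOdd (count sPreimage)
      ≡⟨ cong isOdd (count-partition sPreimage Y) ⟩
    isOdd (count (λ w → sPreimage w ∧ Y w) + count (λ w → sPreimage w ∧ not (Y w)))
      ≡⟨ isOdd-+ (count (λ w → sPreimage w ∧ Y w)) _ ⟩
    isOdd (count (λ w → sPreimage w ∧ Y w)) xor isOdd (count (λ w → sPreimage w ∧ not (Y w)))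
      ≡⟨ cong₂ (λ m m′ → isOdd m xor isOdd m′) (count-cong inside) (count-cong outside) ⟩
    isOdd (count (λ w → sComponent (suc w))) xor isOdd (count (λ w → InGminusB G B′ w ∧ not (Y w)))
      ≡⟨ cong (isOdd (count (λ w → sComponent (suc w))) xor_) (trans outside-parity ȳ-in-sComponent) ⟩
    isOdd (count (λ w → sComponent (suc w))) xor sComponent zero
      ≡⟨ xor-comm _ (sComponent zero) ⟩
    sComponent zero xor isOdd (count (λ w → sComponent (suc w)))
      ≡⟨ cong (_xor isOdd (count (λ w → sComponent (suc w)))) (isOdd-indicator (sComponent zero)) ⟨
    isOdd (indicator (sComponent zero)) xor isOdd (count (λ w → sComponent (suc w)))
      ≡⟨ isOdd-+ (indicator (sComponent zero)) _ ⟨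
    isOdd (count sComponent)
      ∎
    where
    open ≡-Reasoning
    isOdd-indicator : ∀ b → isOdd (indicator b) ≡ b
    isOdd-indicator true  = refl
    isOdd-indicator false = refl
    ȳ-in-sComponent : InGminusB G′ B zero ≡ sComponent zero
    ȳ-in-sComponent = ≡true-ext (λ ȳ∈ → ∧-intro ȳ∈ (reaches?-complete (ȳ-reaches ȳ∈))) (∧-conicalˡ _ _)
    inside : ∀ w → (sPreimage w ∧ Y w) ≡ sComponent (suc w)
    inside w = table (vert G w) (Y w) (B′ w) (B (suc w)) (reaches? (suc w)) (B′-agrees w)
      where
      table : ∀ v y b′ b r → (y ≡ true → b′ ≡ b) →
        ((v ∧ not b′) ∧ (not y ∨ r)) ∧ y ≡ ((v ∧ y) ∧ not b) ∧ r
      table false y     b′ b r _ = refl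
      table true  false b′ b r _ = ∧-zeroʳ (not b′ ∧ true)
      table true  true  b′ b r agree rewrite agree refl with b | r
      ... | true  | _     = refl
      ... | false | true  = refl
      ... | false | false = refl
    outside : ∀ w → (sPreimage w ∧ not (Y w)) ≡ (InGminusB G B′ w ∧ not (Y w))
    outside w = table (InGminusB G B′ w) (Y w) (reaches? (suc w))
      where
      table : ∀ i y r → (i ∧ (not y ∨ r)) ∧ not y ≡ i ∧ not y
      table false _     _     = refl
      table true  false _     = refl
      table true  true  true  = refl
      table true  true  false = refl

  module _ {k′ c′ k c} (lab′ : IsComponentLabelling G′ B k′ c′) (lab : IsComponentLabelling G B′ k c) where
    open Labelling lab′
      renaming (connect to connect′; same-label to same-label′; rep to rep′; rep-∈ to rep′-∈; rep-label to rep′-label)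
    open Labelling lab using (connect; same-label)

    reaching-same-label : ∀ {p q} → Reaches p → Reaches q → c′ p ≡ c′ q
    reaching-same-label p⇝s q⇝s = same-label′ (p⇝s ++ʷ reverse q⇝s)

    avoiding-rep : ∀ i → ¬ Reaches (rep′ i) → ∃ λ z → rep′ i ≡ suc z
    avoiding-rep i ¬reaches with rep′ i in rep≡
    ... | suc z = z , refl
    ... | zero  = ⊥-elim (¬reaches (ȳ-reaches (subst (λ p → InGminusB G′ B p ≡ true) rep≡ (rep′-∈ i))))

    module Avoiding (i : Fin k′) (¬reaches : ¬ Reaches (rep′ i)) where

      z = proj₁ (avoiding-rep i ¬reaches)

      rep′≡suc-z : rep′ i ≡ suc z
      rep′≡suc-z = proj₂ (avoiding-rep i ¬reaches)

      z∈′ : InGminusB G′ B (suc z) ≡ true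
      z∈′ = subst (λ p → InGminusB G′ B p ≡ true) rep′≡suc-z (rep′-∈ i)

      z-label′ : c′ (suc z) ≡ i
      z-label′ = subst (λ p → c′ p ≡ i) rep′≡suc-z (rep′-label i)

      z∈ : InGminusB G B′ z ≡ true
      z∈ = proj₁ (lift-vertex z z∈′)

      Yz : Y z ≡ true
      Yz = proj₂ (lift-vertex z z∈′)

      ¬z-reaches : ¬ Reaches (suc z)
      ¬z-reaches r = ¬reaches (subst Reaches (sym rep′≡suc-z) r)

      ȳ∉component : component G′ B c′ i zero ≡ false
      ȳ∉component = ≡true-ext ȳ∈ (λ ())
        where
        ȳ∈ : component G′ B c′ i zero ≡ true → false ≡ true
        ȳ∈ p = ⊥-elim (¬z-reaches (subst (Walk G′ B (suc z)) (sym (ȳ-is-s (component-∈ G′ B c′ p)))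
                 (connect′ z∈′ (component-∈ G′ B c′ p) (trans z-label′ (sym (component-label G′ B c′ p))))))

      lifted : ∀ w → component G B′ c (c z) w ≡ component G′ B c′ i (suc w)
      lifted w = ≡true-ext to from
        where
        to : component G B′ c (c z) w ≡ true → component G′ B c′ i (suc w) ≡ true
        to p with lift-walk (connect z∈ (component-∈ G B′ c p) (sym (component-label G B′ c p))) Yz
        ... | inj₂ z⇝s       = ⊥-elim (¬z-reaches z⇝s)
        ... | inj₁ (_ , z⇝w) = component-intro G′ B c′ (walk-target z⇝w) (trans (sym (same-label′ z⇝w)) z-label′)
        from : component G′ B c′ i (suc w) ≡ true → component G B′ c (c z) w ≡ true
        from p = component-intro G B′ c (walk-target z⇝w) (sym (same-label z⇝w))
          where
          z⇝w′ = connect′ z∈′ (component-∈ G′ B c′ p) (trans z-label′ (sym (component-label G′ B c′ p)))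
          z⇝w  = project-walk (walk-avoiding z⇝w′ ¬z-reaches)

      count-lifted : count (component G B′ c (c z)) ≡ count (component G′ B c′ i)
      count-lifted = trans (count-cong lifted)
        (cong (λ b → indicator b + count (λ w → component G′ B c′ i (suc w))) (sym ȳ∉component))

    sPreimage-reaches : ∀ {x} → sPreimage x ≡ true → Y x ≡ true → Reaches (suc x)
    sPreimage-reaches {x} p Yx =
      reaches?-sound (subst (λ y → not y ∨ reaches? (suc x) ≡ true) Yx (∧-conicalʳ (InGminusB G B′ x) _ p))

    sPreimage-closed : ∀ {w x} → sPreimage w ≡ true → InGminusB G B′ x ≡ true → c x ≡ c w → sPreimage x ≡ true
    sPreimage-closed {w} {x} w∈ x∈ same with true-or-false (Y x)
    ... | inj₂ ¬Yx = ∧-intro x∈ (subst (λ y → not y ∨ reaches? (suc x) ≡ true) (sym ¬Yx) refl)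
    ... | inj₁ Yx  = ∧-intro x∈ (subst (λ y → not y ∨ reaches? (suc x) ≡ true) (sym Yx) (reaches?-complete x-reaches))
      where
      x-reaches : Reaches (suc x)
      x-reaches with lift-walk (connect x∈ (∧-conicalˡ _ _ w∈) same) Yx
      ... | inj₂ x⇝s        = x⇝s
      ... | inj₁ (Yw , x⇝w) = x⇝w ++ʷ sPreimage-reaches w∈ Yw

    odd-component-in-sPreimage : isOdd (count sPreimage) ≡ true →
      ∃ λ j → ∃ λ w → sPreimage w ≡ true × c w ≡ j × oddLabels G B′ c j ≡ true
    odd-component-in-sPreimage odd = j , w , w∈ , w-label , j-odd
      where
      fibre = λ j x → sPreimage x ∧ ⌊ c x ≟ j ⌋
      odd-fibre = ∑-odd⇒odd-term (λ j → count (fibre j)) (trans (cong isOdd (sym (count-fibres sPreimage c))) odd)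
      j = proj₁ odd-fibre
      member = count-suc⇒member (fibre j) (proj₂ (isOdd⇒nonzero _ (proj₂ odd-fibre)))
      w = proj₁ member
      w∈ = ∧-conicalˡ _ _ (proj₂ member)
      w-label = ⌊≟⌋-sound (∧-conicalʳ (sPreimage w) _ (proj₂ member))
      fibre≗component : fibre j ≗ component G B′ c j
      fibre≗component x = ≡true-ext (λ p → ∧-intro (∧-conicalˡ _ _ (∧-conicalˡ _ _ p)) (∧-conicalʳ (sPreimage x) _ p))
        (λ p → ∧-intro (sPreimage-closed w∈ (component-∈ G B′ c p) (trans (component-label G B′ c p) (sym w-label)))
                       (∧-conicalʳ (InGminusB G B′ x) _ p))
      j-odd = trans (oddLabels≡isOdd G B′ c j) (trans (cong isOdd (sym (count-cong fibre≗component))) (proj₂ odd-fibre))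

    s-image : ∀ i → oddLabels G′ B c′ i ≡ true → Reaches (rep′ i) →
      ∃ λ j → ∃ λ w → sPreimage w ≡ true × c w ≡ j × oddLabels G B′ c j ≡ true
    s-image i odd rep-reaches = odd-component-in-sPreimage (begin
      isOdd (count sPreimage)               ≡⟨ isOdd-sPreimage ⟩
      isOdd (count sComponent)              ≡⟨ cong isOdd (count-cong sComponent≗component) ⟩
      isOdd (count (component G′ B c′ i))   ≡⟨ oddLabels≡isOdd G′ B c′ i ⟨
      oddLabels G′ B c′ i                   ≡⟨ odd ⟩
      true                                  ∎)
      where
      open ≡-Reasoning
      sComponent≗component : sComponent ≗ component G′ B c′ i
      sComponent≗component p = ≡true-ext to from
        where
        to : sComponent p ≡ true → component G′ B c′ i p ≡ true
        to q = component-intro G′ B c′ (∧-conicalˡ _ _ q)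
                 (trans (reaching-same-label (reaches?-sound (∧-conicalʳ (InGminusB G′ B p) _ q)) rep-reaches) (rep′-label i))
        from : component G′ B c′ i p ≡ true → sComponent p ≡ true
        from q = ∧-intro (component-∈ G′ B c′ q) (reaches?-complete
                   (connect′ (component-∈ G′ B c′ q) (rep′-∈ i) (trans (component-label G′ B c′ q) (sym (rep′-label i)))
                    ++ʷ rep-reaches))

    image : ∀ i → oddLabels G′ B c′ i ≡ true → Dec (Reaches (rep′ i)) → Fin k
    image i odd (yes r)       = proj₁ (s-image i odd r)
    image i odd (no ¬reaches) = c (Avoiding.z i ¬reaches)

    image-odd : ∀ i odd d → oddLabels G B′ c (image i odd d) ≡ true
    image-odd i odd (yes r)       = proj₂ (proj₂ (proj₂ (proj₂ (s-image i odd r))))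
    image-odd i odd (no ¬reaches) = trans (cong (λ m → m % 2 ≡ᵇ 1) (Avoiding.count-lifted i ¬reaches)) odd

    s-image≢avoiding-image : ∀ i odd r i′ ¬reaches → proj₁ (s-image i odd r) ≢ c (Avoiding.z i′ ¬reaches)
    s-image≢avoiding-image i odd r i′ ¬reaches eq =
      Avoiding.¬z-reaches i′ ¬reaches
        (sPreimage-reaches (sPreimage-closed w∈ (Avoiding.z∈ i′ ¬reaches) (sym (trans w-label eq))) (Avoiding.Yz i′ ¬reaches))
      where
      w∈ = proj₁ (proj₂ (proj₂ (s-image i odd r)))
      w-label = proj₁ (proj₂ (proj₂ (proj₂ (s-image i odd r))))

    image-injective : ∀ i i′ odd odd′ d d′ → image i odd d ≡ image i′ odd′ d′ → i ≡ i′
    image-injective i i′ odd odd′ (yes r) (yes r′) _  =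
      trans (sym (rep′-label i)) (trans (reaching-same-label r r′) (rep′-label i′))
    image-injective i i′ odd odd′ (yes r) (no ¬r′) eq = ⊥-elim (s-image≢avoiding-image i odd r i′ ¬r′ eq)
    image-injective i i′ odd odd′ (no ¬r) (yes r′) eq = ⊥-elim (s-image≢avoiding-image i′ odd′ r′ i ¬r (sym eq))
    image-injective i i′ odd odd′ (no ¬r) (no ¬r′) eq
      with lift-walk (connect (Avoiding.z∈ i ¬r) (Avoiding.z∈ i′ ¬r′) eq) (Avoiding.Yz i ¬r)
    ... | inj₂ z⇝s       = ⊥-elim (Avoiding.¬z-reaches i ¬r z⇝s)
    ... | inj₁ (_ , z⇝z′) = trans (sym (Avoiding.z-label′ i ¬r)) (trans (same-label′ z⇝z′) (Avoiding.z-label′ i′ ¬r′))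

    oddCount-≤ : oddCount G′ B k′ c′ ≤ oddCount G B′ k c
    oddCount-≤ = count-≤-injection (oddLabels G′ B c′) (oddLabels G B′ c)
      (λ i odd → image i odd (walk? G′ B (rep′ i) s))
      (λ i odd → image-odd i odd (walk? G′ B (rep′ i) s))
      (λ i i′ odd odd′ → image-injective i i′ odd odd′ (walk? G′ B (rep′ i) s) (walk? G′ B (rep′ i′) s))

  G-B′-nonempty : ∀ {k′ c′} → IsComponentLabelling G′ B k′ c′ → ∃ λ w → InGminusB G B′ w ≡ true
  G-B′-nonempty {c′ = c′} lab′ with Labelling.rep lab′ (c′ zero) | Labelling.rep-∈ lab′ (c′ zero)
  ... | suc a | a∈ = a , proj₁ (lift-vertex a a∈)
  ... | zero  | ȳ∈ = w , ∧-conicalˡ _ _ w∈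
    where
    outside-odd = trans outside-parity ȳ∈
    member = count-suc⇒member (λ w → InGminusB G B′ w ∧ not (Y w)) (proj₂ (isOdd⇒nonzero _ outside-odd))
    w  = proj₁ member
    w∈ = proj₂ member

  barrier : Matchable G → (∀ x → B′ x ≡ true → vert G x ≡ true) → count B ≡ count B′ →
    IsBarrier G′ B → IsBarrier G B′
  barrier (m , perfect) B′⊆V |B|≡|B′| (_ , _ , k′ , c′ , lab′ , o≡|B|) =
    (m , perfect) , B′⊆V , k , c , lab ,
    ≤-antisym (oddCount≤count G B′ perfect c lab)
              (subst (_≤ oddCount G B′ k c) (trans o≡|B| |B|≡|B′|) (oddCount-≤ lab′ lab))
    where
    labelling = componentLabelling G B′ (G-B′-nonempty lab′)
    k   = proj₁ labelling
    c   = proj₁ (proj₂ labelling)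
    lab = proj₂ (proj₂ labelling)

-- Two-separation cuts

module TwoSepCutFacts {n} (G : Graph n) {u v Y} (tsc : TwoSepCut G u v Y) where

  private
    S₁ = proj₁ (proj₂ tsc)
    S₂ = proj₁ (proj₂ (proj₂ tsc))
    fields = proj₂ (proj₂ (proj₂ tsc))
    S₁⊆V = proj₁ fields
    covers = proj₁ (proj₂ (proj₂ fields))
    S₁∩S₂ = proj₁ (proj₂ (proj₂ (proj₂ fields)))
    edges-inside = proj₁ (proj₂ (proj₂ (proj₂ (proj₂ fields))))
    |S₁|-even = proj₁ (proj₂ (proj₂ (proj₂ (proj₂ (proj₂ fields)))))
    Y-def = proj₂ (proj₂ (proj₂ (proj₂ (proj₂ (proj₂ (proj₂ fields))))))

    u∈S₁∩S₂ = proj₂ (S₁∩S₂ u) (inj₁ refl)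
    u∈S₁ = ∧-conicalˡ (S₁ u) _ u∈S₁∩S₂
    u∈S₂ = ∧-conicalʳ (S₁ u) _ u∈S₁∩S₂
    v∈S₁ = ∧-conicalˡ (S₁ v) _ (proj₂ (S₁∩S₂ v) (inj₂ refl))
    v≢u : v ≢ u
    v≢u v≡u = proj₁ tsc (sym v≡u)

  v∈V : vert G v ≡ true
  v∈V = S₁⊆V v v∈S₁

  v∉Y : Y v ≡ false
  v∉Y = trans (Y-def v) (trans (cong (λ b → S₂ v ∧ not b) (⌊≟⌋-true {x = v} refl)) (∧-zeroʳ (S₂ v)))

  Y⇒≢v : ∀ {a} → Y a ≡ true → a ≢ v
  Y⇒≢v Ya refl = true≢false (trans (sym Ya) v∉Y)

  Y⊆S₂ : ∀ {a} → Y a ≡ true → S₂ a ≡ true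
  Y⊆S₂ {a} Ya = ∧-conicalˡ _ _ (trans (sym (Y-def a)) Ya)

  ∉S₂⇒∉Y : ∀ {a} → S₂ a ≡ false → Y a ≡ false
  ∉S₂⇒∉Y {a} ∉S₂ = trans (Y-def a) (cong (λ b → b ∧ not ⌊ a ≟ v ⌋) ∉S₂)

  complement-of-Y : ∀ w → (vert G w ∧ not (Y w)) ≡ remove u S₁ w
  complement-of-Y w = ≡true-ext to from
    where
    to : (vert G w ∧ not (Y w)) ≡ true → remove u S₁ w ≡ true
    to p with true-or-false (S₂ w) | w ≟ v
    ... | _           | yes refl = remove-intro S₁ v∈S₁ v≢u
    ... | inj₁ w∈S₂   | no w≢v   = ⊥-elim (true≢false (trans (sym Yw) (not-injective (∧-conicalʳ (vert G w) _ p))))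
      where Yw = trans (Y-def w) (cong₂ (λ b b′ → b ∧ not b′) w∈S₂ (⌊≟⌋-false w≢v))
    ... | inj₂ w∉S₂   | no _     = remove-intro S₁ w∈S₁ (λ { refl → true≢false (trans (sym u∈S₂) w∉S₂) })
      where w∈S₁ = trans (sym (∨-identityʳ (S₁ w))) (subst (λ b → S₁ w ∨ b ≡ true) w∉S₂ (covers w (∧-conicalˡ _ _ p)))
    from : remove u S₁ w ≡ true → (vert G w ∧ not (Y w)) ≡ true
    from p = ∧-intro (S₁⊆V w w∈S₁) (cong not ∉Y)
      where
      w∈S₁ = ∧-conicalˡ _ _ p
      ∉Y : Y w ≡ false
      ∉Y with true-or-false (S₂ w)
      ... | inj₂ w∉S₂ = ∉S₂⇒∉Y w∉S₂
      ... | inj₁ w∈S₂ with proj₁ (S₁∩S₂ w) (∧-intro w∈S₁ w∈S₂)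
      ...   | inj₁ refl = ⊥-elim (remove-≢ S₁ p refl)
      ...   | inj₂ refl = v∉Y

  isOdd-complement-of-Y : isOdd (count (λ w → vert G w ∧ not (Y w))) ≡ true
  isOdd-complement-of-Y = begin
    isOdd (count (λ w → vert G w ∧ not (Y w)))   ≡⟨ cong isOdd (count-cong complement-of-Y) ⟩
    isOdd (count (remove u S₁))                  ≡⟨ not-involutive _ ⟨
    not (isOdd (suc (count (remove u S₁))))      ≡⟨ cong (λ m → not (isOdd m)) (count-remove S₁ u u∈S₁) ⟨
    not (isOdd (count S₁))                       ≡⟨ cong not |S₁|-even′ ⟩
    true                                         ∎
    where
    open ≡-Reasoning
    |S₁|-even′ : isOdd (count S₁) ≡ false
    |S₁|-even′ = trans (sym (%2≡ᵇ1≡isOdd (count S₁))) (cong (_≡ᵇ 1) |S₁|-even)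

  crossing-at-u : ∀ {a b} → Edge G a b → Y a ≡ true → Y b ≡ false → b ≢ v → a ≡ u
  crossing-at-u {a} {b} ab Ya ¬Yb b≢v with proj₁ (S₁∩S₂ a) (∧-intro a∈S₁ (Y⊆S₂ Ya))
    where
    b∉S₂ : S₂ b ≡ false
    b∉S₂ with true-or-false (S₂ b)
    ... | inj₂ p = p
    ... | inj₁ p = ⊥-elim (true≢false (trans (sym (trans (Y-def b) (cong₂ (λ x y → x ∧ not y) p (⌊≟⌋-false b≢v)))) ¬Yb))
    a∈S₁ : S₁ a ≡ true
    a∈S₁ = ∧-conicalˡ _ _ (trans (sym (∨-identityʳ _))
             (trans (sym (cong ((S₁ a ∧ S₁ b) ∨_) (∧-zeroʳ (S₂ a))))
                    (subst (λ x → (S₁ a ∧ S₁ b) ∨ (S₂ a ∧ x) ≡ true) b∉S₂ (edges-inside a b ab))))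
  ... | inj₁ a≡u = a≡u
  ... | inj₂ a≡v = ⊥-elim (Y⇒≢v Ya a≡v)

module BarrierLift {n} (G : Graph n) {u v Y} (tsc : TwoSepCut G u v Y) (B : VSet (suc n))
  (B-barrier : IsBarrier (shrinkComplement G Y) B) (matchable : Matchable G) where

  open TwoSepCutFacts G tsc

  private
    G′ = shrinkComplement G Y

    B⊆V′ : ∀ x → B x ≡ true → vert G′ x ≡ true
    B⊆V′ = proj₁ (proj₂ B-barrier)

    B⊆V : ∀ x → B (suc x) ≡ true → vert G x ≡ true
    B⊆V x Bx = ∧-conicalˡ _ _ (B⊆V′ (suc x) Bx)

    ∉Y⇒∉B : ∀ {x} → Y x ≡ false → B (suc x) ≡ false
    ∉Y⇒∉B {x} ¬Yx with true-or-false (B (suc x))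
    ... | inj₂ ∉B = ∉B
    ... | inj₁ ∈B = ⊥-elim (true≢false (trans (sym (∧-conicalʳ (vert G x) _ (B⊆V′ (suc x) ∈B))) ¬Yx))

  barrier-without-ȳ : B zero ≡ false → IsBarrier G (λ x → B (suc x))
  barrier-without-ȳ ȳ∉B = ContractionComparison.barrier G Y B (λ x → B (suc x)) zero
    (λ _ _ → refl) (λ _ → refl) crossing outside-parity matchable B⊆V
    (cong (λ b → indicator b + count (λ x → B (suc x))) ȳ∉B) B-barrier
    where
    crossing : ∀ a b → Edge G a b → Y a ≡ true → Y b ≡ false → B (suc a) ≡ false → _ → Walk G′ B (suc a) zero
    crossing a b ab Ya ¬Yb a∉B _ = step (edge-to-ȳ G Y ab Ya ¬Yb) a∉B (here refl ȳ∉B)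
    outside-parity : isOdd (count (λ w → InGminusB G (λ x → B (suc x)) w ∧ not (Y w))) ≡ InGminusB G′ B zero
    outside-parity = trans (cong isOdd (count-cong unblocked)) (trans isOdd-complement-of-Y (sym (cong not ȳ∉B)))
      where
      unblocked : ∀ w → (InGminusB G (λ x → B (suc x)) w ∧ not (Y w)) ≡ (vert G w ∧ not (Y w))
      unblocked w with true-or-false (Y w)
      ... | inj₁ Yw  rewrite Yw  = trans (∧-zeroʳ _) (sym (∧-zeroʳ _))
      ... | inj₂ ¬Yw rewrite ¬Yw | ∉Y⇒∉B ¬Yw = cong (_∧ true) (∧-identityʳ (vert G w))

  barrier-with-ȳ : B zero ≡ true → IsBarrier G (λ x → B (suc x) ∨ ⌊ x ≟ v ⌋)
  barrier-with-ȳ ȳ∈B = ContractionComparison.barrier G Y B B′ (suc u)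
    agrees (λ ȳ∈ → ⊥-elim (true≢false (trans (sym ȳ∈) (cong not ȳ∈B)))) crossing outside-parity
    matchable B′⊆V |B|≡|B′| B-barrier
    where
    B′ : VSet n
    B′ x = B (suc x) ∨ ⌊ x ≟ v ⌋
    agrees : ∀ a → Y a ≡ true → B′ a ≡ B (suc a)
    agrees a Ya = trans (cong (B (suc a) ∨_) (⌊≟⌋-false (Y⇒≢v Ya))) (∨-identityʳ _)
    crossing : ∀ a b → Edge G a b → Y a ≡ true → Y b ≡ false → B (suc a) ≡ false →
      InGminusB G B′ b ≡ true → Walk G′ B (suc a) (suc u)
    crossing a b ab Ya ¬Yb a∉B b∈ = subst (λ x → Walk G′ B (suc a) (suc x)) a≡u
      (trivial-walk G′ (InGminusB-intro G′ B (∧-intro (proj₁ ab) Ya) a∉B))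
      where
      a≡u = crossing-at-u ab Ya ¬Yb (⌊≟⌋-false⁻¹ (∨-conicalʳ (B (suc b)) _ (InGminusB-∉ G B′ b b∈)))
    outside-parity : isOdd (count (λ w → InGminusB G B′ w ∧ not (Y w))) ≡ InGminusB G′ B zero
    outside-parity = begin
      isOdd (count (λ w → InGminusB G B′ w ∧ not (Y w)))   ≡⟨ cong isOdd (count-cong unblocked) ⟩
      isOdd (count (remove v Ȳ))                           ≡⟨ not-involutive _ ⟨
      not (isOdd (suc (count (remove v Ȳ))))               ≡⟨ cong (λ m → not (isOdd m)) (count-remove Ȳ v v∈Ȳ) ⟨
      not (isOdd (count Ȳ))                                ≡⟨ cong not isOdd-complement-of-Y ⟩
      false                                                ≡⟨ cong not ȳ∈B ⟨
      InGminusB G′ B zero                                  ∎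
      where
      open ≡-Reasoning
      Ȳ : VSet n
      Ȳ w = vert G w ∧ not (Y w)
      v∈Ȳ = ∧-intro v∈V (cong not v∉Y)
      unblocked : ∀ w → (InGminusB G B′ w ∧ not (Y w)) ≡ remove v Ȳ w
      unblocked w = table (vert G w) (B (suc w)) ⌊ w ≟ v ⌋ (Y w) ∉Y⇒∉B
        where
        table : ∀ i b e y → (y ≡ false → b ≡ false) → (i ∧ not (b ∨ e)) ∧ not y ≡ (i ∧ not y) ∧ not e
        table false _ _ _     _ = refl
        table true  b e true  _ = ∧-zeroʳ (not (b ∨ e))
        table true  b e false unblocked′ rewrite unblocked′ refl = ∧-identityʳ (not e)
    B′⊆V : ∀ x → B′ x ≡ true → vert G x ≡ true
    B′⊆V x B′x with true-or-false (B (suc x))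
    ... | inj₁ Bx  = B⊆V x Bx
    ... | inj₂ ¬Bx = subst (λ y → vert G y ≡ true) (sym x≡v) v∈V
      where x≡v = ⌊≟⌋-sound (subst (λ b → b ∨ ⌊ x ≟ v ⌋ ≡ true) ¬Bx B′x)
    |B|≡|B′| : count B ≡ count B′
    |B|≡|B′| = begin
      count B                        ≡⟨ cong (λ b → indicator b + count (λ x → B (suc x))) ȳ∈B ⟩
      suc (count (λ x → B (suc x)))  ≡⟨ cong suc (count-cong v-removed) ⟨
      suc (count (remove v B′))      ≡⟨ count-remove B′ v (∨-trueʳ (B (suc v)) (⌊≟⌋-true {x = v} refl)) ⟨
      count B′                       ∎
      where
      open ≡-Reasoning
      v-removed : ∀ x → remove v B′ x ≡ B (suc x)
      v-removed x = table (B (suc x)) ⌊ x ≟ v ⌋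
        (λ x≡v → subst (λ y → B (suc y) ≡ false) (sym (⌊≟⌋-sound x≡v)) (∉Y⇒∉B v∉Y))
        where
        table : ∀ b e → (e ≡ true → b ≡ false) → (b ∨ e) ∧ not e ≡ b
        table b false _  = trans (∧-identityʳ (b ∨ false)) (∨-identityʳ b)
        table b true  b∉ rewrite b∉ refl = refl

lemma5 : ∀ {n} (G : Graph n) (u v : Fin n) (Y : VSet n) →
    MatchingCovered G → TwoSepCut G u v Y →
    (B : VSet (ℕ.suc n)) → IsBarrier (shrinkComplement G Y) B →
    (B zero ≡ true → IsBarrier G (λ x → B (suc x) ∨ ⌊ x ≟ v ⌋)) ×
    (B zero ≡ false → IsBarrier G (λ x → B (suc x)))
lemma5 G u v Y mc tsc B B-barrier = barrier-with-ȳ , barrier-without-ȳ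
  where open BarrierLift G tsc B B-barrier (matchingCovered⇒matchable G mc)
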